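{- Let $k$ be a positive integer and let $c$ be a radio labeling of $C_{2k}\square C_{2k}$. Then for any three vertices $u,v,w$ of $C_{2k}\square C_{2k}$ with $c(u)<c(v)<c(w)$, we have $c(w)-c(u)\ge k+2$.
   Context: $C_n$ is the cycle graph with vertex set $\{0,\dots,n-1\}$, $v,w$ adjacent iff $v\equiv w\pm1 \pmod n$. The Cartesian product $G\square H$ has vertex set $V(G)\times V(H)$, with $(g,h)\sim(g',h')$ iff ($g=g'$ and $hh'\in E(H)$) or ($h=h'$ and $gg'\in E(G)$). $d(u,v)$ is graph distance and $\operatorname{diam}(G)$ the maximum distance in $G$. A radio labeling of a connected graph $G$ is a function $c:V(G)\to\{1,2,\dots\}$ with $d(u,v)+|c(u)-c(v)|\ge 1+\operatorname{diam}(G)$ for all distinct $u,v\in V(G)$. -}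

module Defs where

open import Data.Nat using (ℕ; zero; suc; _+_; _≤_; _<_; _∸_)
open import Data.Fin using (Fin; toℕ)
open import Data.Product using (_×_; _,_; Σ; ∃-syntax)
open import Data.Sum using (_⊎_)
open import Relation.Binary.PropositionalEquality using (_≡_)
open import Relation.Nullary using (¬_)

record Graph : Set₁ where
  field
    V   : Set
    Adj : V → V → Set
open Graph public

∣_-_∣ : ℕ → ℕ → ℕ
∣ a - b ∣ = (a ∸ b) + (b ∸ a)

-- Cycle C_n on vertex set {0,…,n-1}: v ~ w iff v ≡ w ± 1 (mod n).
CycleAdj : (n : ℕ) → Fin n → Fin n → Set
CycleAdj n v w =
  (suc (toℕ w) ≡ toℕ v ⊎ (suc (toℕ w) ≡ n × toℕ v ≡ 0))
  ⊎ (suc (toℕ v) ≡ toℕ w ⊎ (suc (toℕ v) ≡ n × toℕ w ≡ 0))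

Cycle : ℕ → Graph
Cycle n = record { V = Fin n ; Adj = CycleAdj n }

_□_ : Graph → Graph → Graph
G □ H = record
  { V   = V G × V H
  ; Adj = λ { (g , h) (g' , h') →
              (g ≡ g' × Adj H h h') ⊎ (h ≡ h' × Adj G g g') } }

data Walk (G : Graph) : V G → V G → ℕ → Set where
  here : ∀ {u} → Walk G u u 0
  step : ∀ {u v w n} → Adj G u v → Walk G v w n → Walk G u w (suc n)

Dist : (G : Graph) → V G → V G → ℕ → Set
Dist G u v d = Walk G u v d × (∀ m → Walk G u v m → d ≤ m)

Diam : Graph → ℕ → Set
Diam G D =
  (∀ u v → ∃[ d ] (Dist G u v d × d ≤ D)) × ∃[ u ] ∃[ v ] Dist G u v D

IsRadioLabeling : (G : Graph) → (V G → ℕ) → Set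
IsRadioLabeling G c =
  (∀ u → 1 ≤ c u) ×
  (∀ D u v d → Diam G D → Dist G u v d → ¬ (u ≡ v) → suc D ≤ d + ∣ c u - c v ∣)

Torus : ℕ → Graph
Torus k = Cycle (2 Data.Nat.* k) □ Cycle (2 Data.Nat.* k)

-- The distance in C_n □ C_n is the sum of the two cyclic distances, and any three points of C_n
-- cut the cycle into three arcs, so their three pairwise distances add up to at most n. Hence the
-- three pairwise distances of u, v, w in C_2k □ C_2k add up to at most 4k, while the diameter is 2k.
-- Adding the three radio conditions, in which the label gaps c v − c u and c w − c v each occur
-- twice in total, gives 3(2k + 1) ≤ 4k + 2(c w − c u), that is c w − c u ≥ k + 3/2.
module Submission where

open import Defs
open import Data.Nat using (ℕ; zero; suc; _+_; _*_; _∸_; _⊓_; _≤_; _<_; z≤n; s≤s)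
open import Data.Nat.Properties hiding (∣-∣-comm)
open import Data.Nat.Tactic.RingSolver using (solve)
open import Data.Fin as Fin using (Fin; toℕ; fromℕ; fromℕ<)
open import Data.Fin.Properties using (toℕ-fromℕ; toℕ-fromℕ<; toℕ-injective; toℕ<n)
open import Data.List using ([]; _∷_)
open import Data.Product using (_×_; _,_; proj₁; proj₂)
open import Data.Sum using (_⊎_; inj₁; inj₂)
open import Relation.Binary.Definitions using (Symmetric)
open import Relation.Binary.PropositionalEquality

[y∸x]+[z∸y]≡z∸x : ∀ {x y z} → x ≤ y → y ≤ z → (y ∸ x) + (z ∸ y) ≡ z ∸ x
[y∸x]+[z∸y]≡z∸x {x} {y} {z} x≤y y≤z = begin
  (y ∸ x) + (z ∸ y)  ≡⟨ +-∸-comm (z ∸ y) x≤y ⟨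
  (y + (z ∸ y)) ∸ x  ≡⟨ cong (_∸ x) (m+[n∸m]≡n y≤z) ⟩
  z ∸ x              ∎
  where open ≡-Reasoning

∣m-n∣≡n∸m : ∀ {m n} → m ≤ n → ∣ m - n ∣ ≡ n ∸ m
∣m-n∣≡n∸m m≤n rewrite m≤n⇒m∸n≡0 m≤n = refl

∣-∣-comm : ∀ m n → ∣ m - n ∣ ≡ ∣ n - m ∣
∣-∣-comm m n = +-comm (m ∸ n) (n ∸ m)

cycleDist : ℕ → ℕ → ℕ → ℕ
cycleDist n a b = ∣ a - b ∣ ⊓ (n ∸ ∣ a - b ∣)

cycleDist-sym : ∀ n a b → cycleDist n a b ≡ cycleDist n b a
cycleDist-sym n a b rewrite ∣-∣-comm a b = refl

cycleDist-self : ∀ n a → cycleDist n a a ≡ 0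
cycleDist-self n a rewrite n∸n≡0 a = refl

-- The two arcs of C_n between a and b have lengths p and q.
cycleDist-arcs : ∀ {n b} a p q → a + p ≡ b → p + q ≡ n → cycleDist n a b ≡ p ⊓ q
cycleDist-arcs a p q refl refl
  rewrite ∣m-n∣≡n∸m (m≤m+n a p) | m+n∸m≡n a p | m+n∸m≡n p q = refl

cycleDist-≤-half : ∀ k a b → cycleDist (2 * k) a b ≤ k
cycleDist-≤-half k a b = ⊓-≤-half ∣ a - b ∣
  where
  ⊓-≤-half : ∀ m → m ⊓ (2 * k ∸ m) ≤ k
  ⊓-≤-half m with ≤-total m k
  ... | inj₁ m≤k = ≤-trans (m⊓n≤m m _) m≤k
  ... | inj₂ k≤m = begin
    m ⊓ (2 * k ∸ m)  ≤⟨ m⊓n≤n m _ ⟩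
    2 * k ∸ m        ≤⟨ ∸-monoʳ-≤ (2 * k) k≤m ⟩
    k + (k + 0) ∸ k  ≡⟨ m+n∸m≡n k (k + 0) ⟩
    k + 0            ≡⟨ +-identityʳ k ⟩
    k                ∎
    where open ≤-Reasoning

k+k≡2*k : ∀ k → k + k ≡ 2 * k
k+k≡2*k k = cong (k +_) (sym (+-identityʳ k))

cycleDist-antipodal : ∀ k → cycleDist (2 * k) 0 k ≡ k
cycleDist-antipodal k = trans (cycleDist-arcs 0 k k refl (k+k≡2*k k)) (⊓-idem k)

-- Three points x, y, z of C_n cut it into arcs x→y, y→z, z→x of lengths p, q, r.
record Arcs (n x y z : ℕ) : Set where
  constructor arcs
  field
    p q r   : ℕ
    p+q+r≡n : p + q + r ≡ n
    xy      : cycleDist n x y ≡ p ⊓ (q + r)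
    yz      : cycleDist n y z ≡ q ⊓ (r + p)
    zx      : cycleDist n z x ≡ r ⊓ (p + q)

arcs-rotate : ∀ {n x y z} → Arcs n x y z → Arcs n y z x
arcs-rotate (arcs p q r sum xy yz zx) =
  arcs q r p (trans (trans (+-comm (q + r) p) (sym (+-assoc p q r))) sum) yz zx xy

arcs-reflect : ∀ {n x y z} → Arcs n x y z → Arcs n z y x
arcs-reflect {n} {x} {y} {z} (arcs p q r sum xy yz zx) =
  arcs q p r (trans (cong (_+ r) (+-comm q p)) sum)
    (trans (cycleDist-sym n z y) (trans yz (cong (q ⊓_) (+-comm r p))))
    (trans (cycleDist-sym n y x) (trans xy (cong (p ⊓_) (+-comm q r))))
    (trans (cycleDist-sym n x z) (trans zx (cong (r ⊓_) (+-comm p q))))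

arcs-sorted : ∀ {n x y z} → x ≤ y → y ≤ z → z < n → Arcs n x y z
arcs-sorted {n} {x} {y} {z} x≤y y≤z z<n =
  from-lengths (y ∸ x) (z ∸ y) (n ∸ (z ∸ x)) (m+[n∸m]≡n x≤y) (m+[n∸m]≡n y≤z) p+q+r≡n
  where
  p+q+r≡n : (y ∸ x) + (z ∸ y) + (n ∸ (z ∸ x)) ≡ n
  p+q+r≡n rewrite [y∸x]+[z∸y]≡z∸x x≤y y≤z = m+[n∸m]≡n (≤-trans (m∸n≤m z x) (<⇒≤ z<n))

  from-lengths : ∀ {n x y z} p q r → x + p ≡ y → y + q ≡ z → p + q + r ≡ n → Arcs n x y z
  from-lengths {x = x} p q r refl refl refl = arcs p q r refl
    (cycleDist-arcs x p (q + r) refl (sym (+-assoc p q r)))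
    (cycleDist-arcs (x + p) q (r + p) refl (solve (p ∷ q ∷ r ∷ [])))
    (trans (cycleDist-sym _ (x + p + q) x)
      (trans (cycleDist-arcs x (p + q) r (sym (+-assoc x p q)) refl) (⊓-comm (p + q) r)))

arcs-any : ∀ {n x y z} → x < n → y < n → z < n → Arcs n x y z
arcs-any {x = x} {y} {z} x<n y<n z<n with ≤-total x y | ≤-total y z | ≤-total x z
... | inj₁ x≤y | inj₁ y≤z | _       = arcs-sorted x≤y y≤z z<n
... | inj₁ x≤y | inj₂ z≤y | inj₁ x≤z = arcs-reflect (arcs-rotate (arcs-sorted x≤z z≤y y<n))
... | inj₁ x≤y | inj₂ z≤y | inj₂ z≤x = arcs-rotate (arcs-sorted z≤x x≤y y<n)
... | inj₂ y≤x | inj₁ y≤z | inj₁ x≤z = arcs-rotate (arcs-reflect (arcs-sorted y≤x x≤z z<n))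
... | inj₂ y≤x | inj₁ y≤z | inj₂ z≤x = arcs-rotate (arcs-rotate (arcs-sorted y≤z z≤x x<n))
... | inj₂ y≤x | inj₂ z≤y | _       = arcs-reflect (arcs-sorted z≤y y≤x x<n)

arc-triangle : ∀ p q r → r ⊓ (p + q) ≤ p ⊓ (q + r) + q ⊓ (r + p)
arc-triangle p q r with ⊓-sel p (q + r) | ⊓-sel q (r + p)
... | inj₁ e₁ | inj₁ e₂ rewrite e₁ | e₂ = m⊓n≤n r (p + q)
... | inj₁ e₁ | inj₂ e₂ rewrite e₁ | e₂ =
  ≤-trans (m⊓n≤m r _) (≤-trans (m≤m+n r p) (m≤n+m (r + p) p))
... | inj₂ e₁ | _ rewrite e₁ =
  ≤-trans (m⊓n≤m r _) (≤-trans (m≤n+m r q) (m≤m+n (q + r) _))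

arc-perimeter : ∀ p q r → p ⊓ (q + r) + q ⊓ (r + p) + r ⊓ (p + q) ≤ p + q + r
arc-perimeter p q r = +-mono-≤ (+-mono-≤ (m⊓n≤m p _) (m⊓n≤m q _)) (m⊓n≤m r _)

cycleDist-triangle : ∀ {n x y z} → x < n → y < n → z < n →
  cycleDist n x z ≤ cycleDist n x y + cycleDist n y z
cycleDist-triangle {n} {x} {z = z} x<n y<n z<n
  with arcs p q r _ xy yz zx ← arcs-any x<n y<n z<n
  rewrite cycleDist-sym n x z | zx | xy | yz = arc-triangle p q r

cycleDist-perimeter : ∀ {n x y z} → x < n → y < n → z < n →
  cycleDist n x y + cycleDist n y z + cycleDist n z x ≤ n
cycleDist-perimeter x<n y<n z<n
  with arcs p q r p+q+r≡n xy yz zx ← arcs-any x<n y<n z<n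
  rewrite xy | yz | zx | sym p+q+r≡n = arc-perimeter p q r

cycleDist-successor : ∀ {n a b} → a < n → suc b ≡ a ⊎ (suc b ≡ n × a ≡ 0) → cycleDist n b a ≤ 1
cycleDist-successor {n} {a} {b} a<n (inj₁ b+1≡a) = begin
  cycleDist n b a  ≡⟨ cycleDist-arcs b 1 (n ∸ 1) (trans (+-comm b 1) b+1≡a) (m+[n∸m]≡n 1≤n) ⟩
  1 ⊓ (n ∸ 1)      ≤⟨ m⊓n≤m 1 _ ⟩
  1                ∎
  where
  open ≤-Reasoning
  1≤n : 1 ≤ n
  1≤n = ≤-trans (s≤s z≤n) a<n
cycleDist-successor {n} {a} {b} _ (inj₂ (b+1≡n , a≡0)) = begin
  cycleDist n b a  ≡⟨ cycleDist-sym n b a ⟩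
  cycleDist n a b  ≡⟨ cycleDist-arcs a b 1 (cong (_+ b) a≡0) (trans (+-comm b 1) b+1≡n) ⟩
  b ⊓ 1            ≤⟨ m⊓n≤n b 1 ⟩
  1                ∎
  where open ≤-Reasoning

cycleDist-adjacent : ∀ {n} {a b : Fin n} → CycleAdj n a b → cycleDist n (toℕ a) (toℕ b) ≤ 1
cycleDist-adjacent {n} {a} {b} (inj₁ b↦a) =
  subst (_≤ 1) (cycleDist-sym n (toℕ b) (toℕ a)) (cycleDist-successor (toℕ<n a) b↦a)
cycleDist-adjacent {b = b} (inj₂ a↦b) = cycleDist-successor (toℕ<n b) a↦b

cycleAdj-sym : ∀ {n} → Symmetric (CycleAdj n)
cycleAdj-sym (inj₁ b↦a) = inj₂ b↦a
cycleAdj-sym (inj₂ a↦b) = inj₁ a↦b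

_++ʷ_ : ∀ {G u v w a b} → Walk G u v a → Walk G v w b → Walk G u w (a + b)
here       ++ʷ q = q
step adj p ++ʷ q = step adj (p ++ʷ q)

reverseʷ : ∀ {G} → Symmetric (Adj G) → ∀ {u v m} → Walk G u v m → Walk G v u m
reverseʷ sym-adj here = here
reverseʷ {G} sym-adj (step {n = m} adj p) =
  subst (Walk G _ _) (+-comm m 1) (reverseʷ sym-adj p ++ʷ step (sym-adj adj) here)

walk-⊓ : ∀ {G u v a b} → Walk G u v a → Walk G u v b → Walk G u v (a ⊓ b)
walk-⊓ {G} {a = a} {b} p q with ⊓-sel a b
... | inj₁ a⊓b≡a = subst (Walk G _ _) (sym a⊓b≡a) p
... | inj₂ a⊓b≡b = subst (Walk G _ _) (sym a⊓b≡b) q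

liftˡ : ∀ {G H g g' m} h → Walk G g g' m → Walk (G □ H) (g , h) (g' , h) m
liftˡ h here         = here
liftˡ h (step adj p) = step (inj₂ (refl , adj)) (liftˡ h p)

liftʳ : ∀ {G H h h' m} g → Walk H h h' m → Walk (G □ H) (g , h) (g , h') m
liftʳ g here         = here
liftʳ g (step adj p) = step (inj₁ (refl , adj)) (liftʳ g p)

-- d is 1-Lipschitz along edges and realised by walks, hence it is the graph distance.
record DistanceFunction (G : Graph) : Set where
  field
    d        : V G → V G → ℕ
    d-self   : ∀ u → d u u ≡ 0
    d-step   : ∀ {u u'} w → Adj G u u' → d u w ≤ suc (d u' w)
    geodesic : ∀ u v → Walk G u v (d u v)

  d≤length : ∀ {u v m} → Walk G u v m → d u v ≤ m
  d≤length {u} here            = ≤-reflexive (d-self u)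
  d≤length {v = v} (step adj p) = ≤-trans (d-step v adj) (s≤s (d≤length p))

  isDist : ∀ u v → Dist G u v (d u v)
  isDist u v = geodesic u v , λ _ → d≤length

  diameter : ∀ {D} → (∀ u v → d u v ≤ D) → ∀ u v → d u v ≡ D → Diam G D
  diameter d≤D u v d≡D =
    (λ u v → d u v , isDist u v , d≤D u v) , u , v , subst (Dist G u v) d≡D (isDist u v)

open DistanceFunction

_□ᵈ_ : ∀ {G H} → DistanceFunction G → DistanceFunction H → DistanceFunction (G □ H)
_□ᵈ_ {G} {H} dG dH = record
  { d        = λ { (g , h) (g' , h') → d dG g g' + d dH h h' }
  ; d-self   = λ { (g , h) → cong₂ _+_ (d-self dG g) (d-self dH h) }
  ; d-step   = step-□
  ; geodesic = λ { (g , h) (g' , h') → liftˡ h (geodesic dG g g') ++ʷ liftʳ g' (geodesic dH h h') }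
  }
  where
  step-□ : ∀ {u u'} w → Adj (G □ H) u u' →
    d dG (proj₁ u) (proj₁ w) + d dH (proj₂ u) (proj₂ w)
      ≤ suc (d dG (proj₁ u') (proj₁ w) + d dH (proj₂ u') (proj₂ w))
  step-□ {g , h} {_ , h'} (g'' , h'') (inj₁ (refl , adj)) =
    subst (d dG g g'' + d dH h h'' ≤_) (+-suc (d dG g g'') (d dH h' h''))
      (+-monoʳ-≤ (d dG g g'') (d-step dH h'' adj))
  step-□ (g'' , h'') (inj₂ (refl , adj)) = +-monoˡ-≤ _ (d-step dG g'' adj)

forwardWalk : ∀ {n} t (a b : Fin n) → toℕ a + t ≡ toℕ b → Walk (Cycle n) a b t
forwardWalk zero a b a+0≡b =
  subst (λ b → Walk (Cycle _) a b 0) (toℕ-injective (trans (sym (+-identityʳ (toℕ a))) a+0≡b)) here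
forwardWalk {n} (suc t) a b a+[1+t]≡b =
  step (inj₂ (inj₁ (sym (toℕ-fromℕ< a+1<n)))) (forwardWalk t a' b a'+t≡b)
  where
  a+1+t≡b : suc (toℕ a) + t ≡ toℕ b
  a+1+t≡b = trans (sym (+-suc (toℕ a) t)) a+[1+t]≡b
  a+1<n : suc (toℕ a) < n
  a+1<n = ≤-<-trans (m≤m+n (suc (toℕ a)) t) (subst (_< n) (sym a+1+t≡b) (toℕ<n b))
  a' : Fin n
  a' = fromℕ< a+1<n
  a'+t≡b : toℕ a' + t ≡ toℕ b
  a'+t≡b = trans (cong (_+ t) (toℕ-fromℕ< a+1<n)) a+1+t≡b

wrapWalk : ∀ {m} (a b : Fin (suc m)) → Walk (Cycle (suc m)) b a ((m ∸ toℕ b) + suc (toℕ a))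
wrapWalk {m} a b =
  forwardWalk (m ∸ toℕ b) b (fromℕ m) b+[m∸b]≡m
    ++ʷ step last↦zero (forwardWalk (toℕ a) Fin.zero a refl)
  where
  b+[m∸b]≡m : toℕ b + (m ∸ toℕ b) ≡ toℕ (fromℕ m)
  b+[m∸b]≡m = trans (m+[n∸m]≡n (≤-pred (toℕ<n b))) (sym (toℕ-fromℕ m))
  last↦zero : CycleAdj (suc m) (fromℕ m) Fin.zero
  last↦zero = inj₂ (inj₂ (cong suc (toℕ-fromℕ m) , refl))

cycleGeodesic-≤ : ∀ {m} (a b : Fin (suc m)) → toℕ a ≤ toℕ b →
  Walk (Cycle (suc m)) a b (cycleDist (suc m) (toℕ a) (toℕ b))
cycleGeodesic-≤ {m} a b a≤b =
  subst (Walk _ a b) (sym (cycleDist-arcs (toℕ a) p q (m+[n∸m]≡n a≤b) p+q≡n))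
    (walk-⊓ (forwardWalk p a b (m+[n∸m]≡n a≤b)) (reverseʷ cycleAdj-sym (wrapWalk a b)))
  where
  p q : ℕ
  p = toℕ b ∸ toℕ a
  q = (m ∸ toℕ b) + suc (toℕ a)
  b≤m : toℕ b ≤ m
  b≤m = ≤-pred (toℕ<n b)
  p+q≡n : p + q ≡ suc m
  p+q≡n = begin
    p + ((m ∸ toℕ b) + suc (toℕ a))  ≡⟨ +-assoc p _ _ ⟨
    (p + (m ∸ toℕ b)) + suc (toℕ a)  ≡⟨ cong (_+ suc (toℕ a)) ([y∸x]+[z∸y]≡z∸x a≤b b≤m) ⟩
    (m ∸ toℕ a) + suc (toℕ a)        ≡⟨ +-suc (m ∸ toℕ a) (toℕ a) ⟩
    suc ((m ∸ toℕ a) + toℕ a)        ≡⟨ cong suc (m∸n+n≡m (≤-trans a≤b b≤m)) ⟩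
    suc m                            ∎
    where open ≡-Reasoning

cycleGeodesic : ∀ {n} (a b : Fin n) → Walk (Cycle n) a b (cycleDist n (toℕ a) (toℕ b))
cycleGeodesic {suc m} a b with ≤-total (toℕ a) (toℕ b)
... | inj₁ a≤b = cycleGeodesic-≤ a b a≤b
... | inj₂ b≤a =
  subst (Walk _ a b) (cycleDist-sym (suc m) (toℕ b) (toℕ a))
    (reverseʷ cycleAdj-sym (cycleGeodesic-≤ b a b≤a))

cycleDistance : ∀ n → DistanceFunction (Cycle n)
cycleDistance n = record
  { d        = λ a b → cycleDist n (toℕ a) (toℕ b)
  ; d-self   = λ a → cycleDist-self n (toℕ a)
  ; d-step   = step-cycle
  ; geodesic = cycleGeodesic
  }
  where
  step-cycle : ∀ {a a'} b → CycleAdj n a a' →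
    cycleDist n (toℕ a) (toℕ b) ≤ suc (cycleDist n (toℕ a') (toℕ b))
  step-cycle {a} {a'} b adj =
    ≤-trans (cycleDist-triangle (toℕ<n a) (toℕ<n a') (toℕ<n b)) (+-monoˡ-≤ _ (cycleDist-adjacent adj))

torusDistance : ∀ n → DistanceFunction (Cycle n □ Cycle n)
torusDistance n = cycleDistance n □ᵈ cycleDistance n

torus-perimeter : ∀ n (u v w : V (Cycle n □ Cycle n)) →
  let δ = d (torusDistance n) in δ u v + δ v w + δ w u ≤ n + n
torus-perimeter n (a₁ , b₁) (a₂ , b₂) (a₃ , b₃) =
  subst (_≤ n + n) (regroup (δ a₁ a₂) (δ b₁ b₂) (δ a₂ a₃) (δ b₂ b₃) (δ a₃ a₁) (δ b₃ b₁))
    (+-mono-≤ (perimeter a₁ a₂ a₃) (perimeter b₁ b₂ b₃))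
  where
  δ : Fin n → Fin n → ℕ
  δ a b = cycleDist n (toℕ a) (toℕ b)
  perimeter : ∀ a b c → δ a b + δ b c + δ c a ≤ n
  perimeter a b c = cycleDist-perimeter (toℕ<n a) (toℕ<n b) (toℕ<n c)
  regroup : ∀ x₁ y₁ x₂ y₂ x₃ y₃ →
    (x₁ + x₂ + x₃) + (y₁ + y₂ + y₃) ≡ (x₁ + y₁) + (x₂ + y₂) + (x₃ + y₃)
  regroup x₁ y₁ x₂ y₂ x₃ y₃ = solve (x₁ ∷ y₁ ∷ x₂ ∷ y₂ ∷ x₃ ∷ y₃ ∷ [])

torus-diam : ∀ k → 1 ≤ k → Diam (Torus k) (2 * k)
torus-diam (suc k) _ = diameter (torusDistance n) d≤n (Fin.zero , Fin.zero) (κ , κ) d≡n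
  where
  n = 2 * suc k
  k<n : suc k < n
  k<n = m<m+n (suc k) (s≤s z≤n)
  κ : Fin n
  κ = fromℕ< k<n
  d≤n : ∀ u v → d (torusDistance n) u v ≤ n
  d≤n (a , b) (a' , b') = ≤-trans
    (+-mono-≤ (cycleDist-≤-half (suc k) (toℕ a) (toℕ a')) (cycleDist-≤-half (suc k) (toℕ b) (toℕ b')))
    (≤-reflexive (k+k≡2*k (suc k)))
  d≡n : d (torusDistance n) (Fin.zero , Fin.zero) (κ , κ) ≡ n
  d≡n = trans (cong₂ _+_ 0↔κ 0↔κ) (k+k≡2*k (suc k))
    where
    0↔κ : cycleDist n 0 (toℕ κ) ≡ suc k
    0↔κ = trans (cong (cycleDist n 0) (toℕ-fromℕ< k<n)) (cycleDist-antipodal (suc k))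

radio-conditions-sum : ∀ {D d₁ d₂ d₃} a b → d₁ + d₂ + d₃ ≤ D + D →
  suc D ≤ d₁ + a → suc D ≤ d₂ + b → suc D ≤ d₃ + (a + b) → 3 + D ≤ (a + b) + (a + b)
radio-conditions-sum {D} {d₁} {d₂} {d₃} a b d≤2D h₁ h₂ h₃ = +-cancelˡ-≤ (D + D) _ _ (begin
  D + D + (3 + D)                       ≡⟨ solve (D ∷ []) ⟩
  suc D + suc D + suc D                 ≤⟨ +-mono-≤ (+-mono-≤ h₁ h₂) h₃ ⟩
  (d₁ + a) + (d₂ + b) + (d₃ + (a + b))  ≡⟨ solve (d₁ ∷ d₂ ∷ d₃ ∷ a ∷ b ∷ []) ⟩
  (d₁ + d₂ + d₃) + ((a + b) + (a + b))  ≤⟨ +-monoˡ-≤ _ d≤2D ⟩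
  D + D + ((a + b) + (a + b))           ∎)
  where open ≤-Reasoning

radio-spread : ∀ {D d₁ d₂ d₃ x y z} → x ≤ y → y ≤ z → d₁ + d₂ + d₃ ≤ D + D →
  suc D ≤ d₁ + ∣ x - y ∣ → suc D ≤ d₂ + ∣ y - z ∣ → suc D ≤ d₃ + ∣ z - x ∣ →
  3 + D ≤ (z ∸ x) + (z ∸ x)
radio-spread {x = x} {y} {z} x≤y y≤z d≤2D h₁ h₂ h₃
  rewrite ∣m-n∣≡n∸m x≤y | ∣m-n∣≡n∸m y≤z | ∣-∣-comm z x | ∣m-n∣≡n∸m (≤-trans x≤y y≤z)
        | sym ([y∸x]+[z∸y]≡z∸x x≤y y≤z)
  = radio-conditions-sum (y ∸ x) (z ∸ y) d≤2D h₁ h₂ h₃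

3+2k≤s+s⇒k+2≤s : ∀ k s → 3 + 2 * k ≤ s + s → k + 2 ≤ s
3+2k≤s+s⇒k+2≤s k s 3+2k≤2s = ≮⇒≥ λ s<k+2 → <⇒≱ 2+2k<2s (+-mono-≤ (s≤1+k s<k+2) (s≤1+k s<k+2))
  where
  2+2k<2s : suc k + suc k < s + s
  2+2k<2s = ≤-trans (≤-reflexive (trans (cong (λ m → suc (suc m)) (+-suc k k)) (cong (3 +_) (k+k≡2*k k))))
                    3+2k≤2s
  s≤1+k : s < k + 2 → s ≤ suc k
  s≤1+k s<k+2 = ≤-pred (subst (suc s ≤_) (+-comm k 2) s<k+2)

lemma2p2 : (k : ℕ) → 1 ≤ k → (c : V (Torus k) → ℕ) → IsRadioLabeling (Torus k) c →
    ∀ u v w → c u < c v → c v < c w → k + 2 ≤ c w ∸ c u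
lemma2p2 k k≥1 c (_ , radio) u v w cu<cv cv<cw =
  3+2k≤s+s⇒k+2≤s k (c w ∸ c u)
    (radio-spread {d₁ = d T u v} {d₂ = d T v w} {d₃ = d T w u} (<⇒≤ cu<cv) (<⇒≤ cv<cw)
      (torus-perimeter (2 * k) u v w)
      (radio-at u v (labels-distinct cu<cv))
      (radio-at v w (labels-distinct cv<cw))
      (radio-at w u (≢-sym (labels-distinct (<-trans cu<cv cv<cw)))))
  where
  T = torusDistance (2 * k)
  labels-distinct : ∀ {x y} → c x < c y → x ≢ y
  labels-distinct cx<cy x≡y = <-irrefl (cong c x≡y) cx<cy
  radio-at : ∀ x y → x ≢ y → suc (2 * k) ≤ d T x y + ∣ c x - c y ∣
  radio-at x y = radio (2 * k) x y (d T x y) (torus-diam k k≥1) (isDist T x y)
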